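{- Every ap-dioid $(S,+,\cdot,0,1_\sigma,a)$ is a dp-dioid with domain operation $d=a\circ a$, i.e. $d(x)=a(a(x))$.
   Context: A proto-dioid is a structure $(S,+,\cdot,0,1_\sigma)$ such that $+$ is associative, commutative, idempotent with unit $0$ (order $x\le y\iff x+y=y$), and $1_\sigma\cdot x=x$, $x\cdot 1_\sigma=x$, $x\cdot y+x\cdot z\le x\cdot(y+z)$, $(x+y)\cdot z=x\cdot z+y\cdot z$, $0\cdot x=0$. An ap-dioid is a proto-dioid with a unary operation $a$ such that $x\cdot(y\cdot z)=(x\cdot y)\cdot z$ whenever one of $x,y,z$ equals $a(w)$ for some $w$, and $a(x)\cdot x=0$, $a(x\cdot y)=a(x\cdot a(a(y)))$, $a(x)+a(a(x))=1_\sigma$, $a(x)\cdot(y+z)=a(x)\cdot y+a(x)\cdot z$. A dp-dioid is a proto-dioid with a unary operation $d$ such that $x\cdot(y\cdot z)=(x\cdot y)\cdot z$ whenever one of $x,y,z$ equals $d(w)$ for some $w$, and $x\le d(x)\cdot x$, $d(x\cdot y)=d(x\cdot d(y))$, $d(x+y)=d(x)+d(y)$, $d(x)\le 1_\sigma$, $d(0)=0$. -}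

module Defs where

open import Level using (Level; suc)
open import Relation.Binary.PropositionalEquality using (_≡_)
import Data.Product
open Data.Product using (∃-syntax)

record ProtoDioid (ℓ : Level) : Set (suc ℓ) where
  infixl 6 _+_
  infixl 7 _·_
  infix 4 _≤_
  field
    S   : Set ℓ
    _+_ : S → S → S
    _·_ : S → S → S
    𝟘   : S
    1σ  : S

  _≤_ : S → S → Set ℓ
  x ≤ y = x + y ≡ y

  field
    +-assoc       : ∀ x y z → (x + y) + z ≡ x + (y + z)
    +-comm        : ∀ x y → x + y ≡ y + x
    +-idem        : ∀ x → x + x ≡ x
    +-identityˡ   : ∀ x → 𝟘 + x ≡ x
    +-identityʳ   : ∀ x → x + 𝟘 ≡ x
    ·-identityˡ   : ∀ x → 1σ · x ≡ x
    ·-identityʳ   : ∀ x → x · 1σ ≡ x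
    ·-subdistribˡ : ∀ x y z → x · y + x · z ≤ x · (y + z)
    ·-distribʳ    : ∀ x y z → (x + y) · z ≡ x · z + y · z
    ·-zeroˡ       : ∀ x → 𝟘 · x ≡ 𝟘

module _ {ℓ : Level} (P : ProtoDioid ℓ) where
  open ProtoDioid P

  InImage : (S → S) → S → Set ℓ
  InImage f u = ∃[ w ] f w ≡ u

  AssocOnImage : (S → S) → Set ℓ
  AssocOnImage f =
    (∀ x y z → InImage f x → x · (y · z) ≡ (x · y) · z) Data.Product.×
    (∀ x y z → InImage f y → x · (y · z) ≡ (x · y) · z) Data.Product.×
    (∀ x y z → InImage f z → x · (y · z) ≡ (x · y) · z)

  record IsApDioid (a : S → S) : Set ℓ where
    field
      assoc     : AssocOnImage a
      a-annihil : ∀ x → a x · x ≡ 𝟘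
      a-local   : ∀ x y → a (x · y) ≡ a (x · a (a y))
      a-compl   : ∀ x → a x + a (a x) ≡ 1σ
      a-distribˡ : ∀ x y z → a x · (y + z) ≡ a x · y + a x · z

  record IsDpDioid (d : S → S) : Set ℓ where
    field
      assoc    : AssocOnImage d
      d-absorb : ∀ x → x ≤ d x · x
      d-local  : ∀ x y → d (x · y) ≡ d (x · d y)
      d-add    : ∀ x y → d (x + y) ≡ d x + d y
      d-subid  : ∀ x → d x ≤ 1σ
      d-zero   : d 𝟘 ≡ 𝟘

-- In an ap-dioid the elements a w behave as Boolean tests: they lie below 1σ, commute with
-- each other, and a w, a (a w) are complements.  Locality gives a ∘ a ∘ a = a and shows
-- that z · y ≡ 𝟘 forces z · a (a y) ≡ 𝟘; hence a w · y ≡ 𝟘 implies a w ≤ a y, which makes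
-- a antitone on tests and d = a ∘ a monotone, so d x + d y ≤ d (x + y).  Conversely
-- d (x + y) splits along the tests a x and a y, and its part below a x · a y vanishes
-- because a x · a y annihilates x + y.
module Submission where

open import Defs
open import Level using (Level)
open import Data.Product using (_,_; proj₁)
open import Relation.Binary.PropositionalEquality
  using (_≡_; refl; sym; trans; cong; subst; module ≡-Reasoning)

module ProtoDioidProperties {ℓ : Level} (P : ProtoDioid ℓ) where
  open ProtoDioid P
  open ≡-Reasoning

  x≤x+y : ∀ x y → x ≤ x + y
  x≤x+y x y = trans (sym (+-assoc x x y)) (cong (_+ y) (+-idem x))

  y≤x+y : ∀ x y → y ≤ x + y
  y≤x+y x y rewrite +-comm x y = x≤x+y y x

  ≤-antisym : ∀ {x y} → x ≤ y → y ≤ x → x ≡ y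
  ≤-antisym {x} {y} x≤y y≤x = trans (sym y≤x) (trans (+-comm y x) x≤y)

  ≤-trans : ∀ {x y z} → x ≤ y → y ≤ z → x ≤ z
  ≤-trans {x} {y} {z} x≤y y≤z = begin
    x + z       ≡⟨ cong (x +_) (sym y≤z) ⟩
    x + (y + z) ≡⟨ sym (+-assoc x y z) ⟩
    (x + y) + z ≡⟨ cong (_+ z) x≤y ⟩
    y + z       ≡⟨ y≤z ⟩
    z           ∎

  +-lub : ∀ {x y z} → x ≤ z → y ≤ z → x + y ≤ z
  +-lub {x} {y} {z} x≤z y≤z = trans (+-assoc x y z) (trans (cong (x +_) y≤z) x≤z)

  ≤𝟘⇒≡𝟘 : ∀ {x} → x ≤ 𝟘 → x ≡ 𝟘
  ≤𝟘⇒≡𝟘 {x} x≤𝟘 = trans (sym (+-identityʳ x)) x≤𝟘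

  +-conicalˡ : ∀ x y → x + y ≡ 𝟘 → x ≡ 𝟘
  +-conicalˡ x y x+y≡𝟘 = ≤𝟘⇒≡𝟘 (subst (x ≤_) x+y≡𝟘 (x≤x+y x y))

  +-conicalʳ : ∀ x y → x + y ≡ 𝟘 → y ≡ 𝟘
  +-conicalʳ x y x+y≡𝟘 = +-conicalˡ y x (trans (+-comm y x) x+y≡𝟘)

  ·-monoˡ-≤ : ∀ z {x y} → x ≤ y → x · z ≤ y · z
  ·-monoˡ-≤ z {x} {y} x≤y = trans (sym (·-distribʳ x y z)) (cong (_· z) x≤y)

  InImage-∘ : ∀ (f g : S → S) {u} → InImage P (λ x → f (g x)) u → InImage P f u
  InImage-∘ f g (w , fgw≡u) = g w , fgw≡u

  AssocOnImage-⊆ : ∀ {f g : S → S} → (∀ {u} → InImage P g u → InImage P f u) →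
    AssocOnImage P f → AssocOnImage P g
  AssocOnImage-⊆ g⊆f (assoc₁ , assoc₂ , assoc₃) =
    (λ x y z p → assoc₁ x y z (g⊆f p)) ,
    (λ x y z p → assoc₂ x y z (g⊆f p)) ,
    (λ x y z p → assoc₃ x y z (g⊆f p))

module ApDioidProperties {ℓ : Level} (P : ProtoDioid ℓ) (a : ProtoDioid.S P → ProtoDioid.S P)
                         (ap : IsApDioid P a) where
  open ProtoDioid P
  open IsApDioid ap
  open ProtoDioidProperties P
  open ≡-Reasoning

  d : S → S
  d x = a (a x)

  a-assoc : ∀ w y z → a w · (y · z) ≡ (a w · y) · z
  a-assoc w y z = proj₁ assoc (a w) y z (w , refl)

  a∘d≡a : ∀ x → a (d x) ≡ a x
  a∘d≡a x = begin
    a (d x)       ≡⟨ cong a (sym (·-identityˡ (d x))) ⟩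
    a (1σ · d x)  ≡⟨ sym (a-local 1σ x) ⟩
    a (1σ · x)    ≡⟨ cong a (·-identityˡ x) ⟩
    a x           ∎

  a-1σ : a 1σ ≡ 𝟘
  a-1σ = trans (sym (·-identityʳ (a 1σ))) (a-annihil 1σ)

  a-𝟘 : a 𝟘 ≡ 1σ
  a-𝟘 = begin
    a 𝟘           ≡⟨ sym (+-identityˡ (a 𝟘)) ⟩
    𝟘 + a 𝟘       ≡⟨ cong (λ t → t + a t) (sym a-1σ) ⟩
    a 1σ + d 1σ   ≡⟨ a-compl 1σ ⟩
    1σ            ∎

  a≤1σ : ∀ w → a w ≤ 1σ
  a≤1σ w = subst (a w ≤_) (a-compl w) (x≤x+y (a w) (d w))

  a-splitˡ : ∀ w z → z ≡ a w · z + d w · z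
  a-splitˡ w z = begin
    z                     ≡⟨ sym (·-identityˡ z) ⟩
    1σ · z                ≡⟨ cong (_· z) (sym (a-compl w)) ⟩
    (a w + d w) · z       ≡⟨ ·-distribʳ (a w) (d w) z ⟩
    a w · z + d w · z     ∎

  a-splitʳ : ∀ v w → a v ≡ a v · a w + a v · d w
  a-splitʳ v w = begin
    a v                     ≡⟨ sym (·-identityʳ (a v)) ⟩
    a v · 1σ                ≡⟨ cong (a v ·_) (sym (a-compl w)) ⟩
    a v · (a w + d w)       ≡⟨ a-distribˡ v (a w) (d w) ⟩
    a v · a w + a v · d w   ∎

  a·z≤z : ∀ w z → a w · z ≤ z
  a·z≤z w z = begin
    a w · z + z                       ≡⟨ cong (a w · z +_) (a-splitˡ w z) ⟩
    a w · z + (a w · z + d w · z)     ≡⟨ x≤x+y (a w · z) (d w · z) ⟩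
    a w · z + d w · z                 ≡⟨ sym (a-splitˡ w z) ⟩
    z                                 ∎

  a·-monoʳ-≤ : ∀ w {y z} → y ≤ z → a w · y ≤ a w · z
  a·-monoʳ-≤ w {y} {z} y≤z = trans (sym (a-distribˡ w y z)) (cong (a w ·_) y≤z)

  a·z≤a : ∀ w z → z ≤ 1σ → a w · z ≤ a w
  a·z≤a w z z≤1σ = subst (a w · z ≤_) (·-identityʳ (a w)) (a·-monoʳ-≤ w z≤1σ)

  a·𝟘≡𝟘 : ∀ w → a w · 𝟘 ≡ 𝟘
  a·𝟘≡𝟘 w = ≤𝟘⇒≡𝟘 (a·z≤z w 𝟘)

  a·d≡𝟘 : ∀ w → a w · d w ≡ 𝟘
  a·d≡𝟘 w = trans (cong (_· d w) (sym (a∘d≡a w))) (a-annihil (d w))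

  a·z·y≡𝟘 : ∀ w z y → z ≤ 1σ → a w · y ≡ 𝟘 → (a w · z) · y ≡ 𝟘
  a·z·y≡𝟘 w z y z≤1σ a·y≡𝟘 =
    ≤𝟘⇒≡𝟘 (trans (cong ((a w · z) · y +_) (sym a·y≡𝟘))
                 (trans (·-monoˡ-≤ y (a·z≤a w z z≤1σ)) a·y≡𝟘))

  a-comm : ∀ u v → a u · a v ≡ a v · a u
  a-comm u v = trans left (sym right)
    where
    left : a u · a v ≡ a v · (a u · a v)
    left = begin
      a u · a v                                     ≡⟨ a-splitˡ v (a u · a v) ⟩
      a v · (a u · a v) + d v · (a u · a v)         ≡⟨ cong (a v · (a u · a v) +_) vanish ⟩
      a v · (a u · a v) + 𝟘                         ≡⟨ +-identityʳ _ ⟩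
      a v · (a u · a v)                             ∎
      where
      vanish : d v · (a u · a v) ≡ 𝟘
      vanish = trans (a-assoc (a v) (a u) (a v))
                     (a·z·y≡𝟘 (a v) (a u) (a v) (a≤1σ u) (a-annihil (a v)))
    right : a v · a u ≡ a v · (a u · a v)
    right = begin
      a v · a u                                     ≡⟨ cong (a v ·_) (a-splitʳ u v) ⟩
      a v · (a u · a v + a u · d v)                 ≡⟨ a-distribˡ v _ _ ⟩
      a v · (a u · a v) + a v · (a u · d v)         ≡⟨ cong (a v · (a u · a v) +_) vanish ⟩
      a v · (a u · a v) + 𝟘                         ≡⟨ +-identityʳ _ ⟩
      a v · (a u · a v)                             ∎
      where
      vanish : a v · (a u · d v) ≡ 𝟘
      vanish = trans (a-assoc v (a u) (d v)) (a·z·y≡𝟘 v (a u) (d v) (a≤1σ u) (a·d≡𝟘 v))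

  a-comm-· : ∀ w u v → a w · (a u · a v) ≡ (a u · a v) · a w
  a-comm-· w u v = begin
    a w · (a u · a v)     ≡⟨ a-assoc w (a u) (a v) ⟩
    (a w · a u) · a v     ≡⟨ cong (_· a v) (a-comm w u) ⟩
    (a u · a w) · a v     ≡⟨ sym (a-assoc u (a w) (a v)) ⟩
    a u · (a w · a v)     ≡⟨ cong (a u ·_) (a-comm w v) ⟩
    a u · (a v · a w)     ≡⟨ a-assoc u (a v) (a w) ⟩
    (a u · a v) · a w     ∎

  ·≡𝟘⇒·d≡𝟘 : ∀ z y → z · y ≡ 𝟘 → z · d y ≡ 𝟘
  ·≡𝟘⇒·d≡𝟘 z y z·y≡𝟘 = begin
    z · d y                         ≡⟨ sym (·-identityˡ _) ⟩
    1σ · (z · d y)                  ≡⟨ cong (_· (z · d y)) (sym a[z·dy]≡1σ) ⟩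
    a (z · d y) · (z · d y)         ≡⟨ a-annihil _ ⟩
    𝟘                               ∎
    where
    a[z·dy]≡1σ : a (z · d y) ≡ 1σ
    a[z·dy]≡1σ = trans (sym (a-local z y)) (trans (cong a z·y≡𝟘) a-𝟘)

  a·≡𝟘⇒a≤a : ∀ w y → a w · y ≡ 𝟘 → a w ≤ a y
  a·≡𝟘⇒a≤a w y a·y≡𝟘 = trans (cong (a w +_) a-expand) (trans (x≤x+y (a w) _) (sym a-expand))
    where
    a·ay≡a : a w · a y ≡ a w
    a·ay≡a = sym (begin
      a w                           ≡⟨ a-splitʳ w y ⟩
      a w · a y + a w · d y         ≡⟨ cong (a w · a y +_) (·≡𝟘⇒·d≡𝟘 (a w) y a·y≡𝟘) ⟩
      a w · a y + 𝟘                 ≡⟨ +-identityʳ _ ⟩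
      a w · a y                     ∎)
    a-expand : a y ≡ a w + d w · a y
    a-expand = trans (a-splitˡ w (a y)) (cong (_+ d w · a y) a·ay≡a)

  a-antitone : ∀ u v → a u ≤ a v → d v ≤ d u
  a-antitone u v au≤av = a·≡𝟘⇒a≤a (a v) (a u) (≤𝟘⇒≡𝟘 (begin
    d v · a u + 𝟘           ≡⟨ cong (d v · a u +_) (sym (a-annihil (a v))) ⟩
    d v · a u + d v · a v   ≡⟨ a·-monoʳ-≤ (a v) au≤av ⟩
    d v · a v               ≡⟨ a-annihil (a v) ⟩
    𝟘                       ∎))

  a·≡𝟘⇒d≤d : ∀ w y → a w · y ≡ 𝟘 → d y ≤ d w
  a·≡𝟘⇒d≤d w y a·y≡𝟘 = a-antitone w y (a·≡𝟘⇒a≤a w y a·y≡𝟘)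

  x≤d·x : ∀ x → x ≤ d x · x
  x≤d·x x = trans (cong (_+ d x · x) x≡d·x) (+-idem _)
    where
    x≡d·x : x ≡ d x · x
    x≡d·x = begin
      x                     ≡⟨ a-splitˡ x x ⟩
      a x · x + d x · x     ≡⟨ cong (_+ d x · x) (a-annihil x) ⟩
      𝟘 + d x · x           ≡⟨ +-identityˡ _ ⟩
      d x · x               ∎

  d-local : ∀ x y → d (x · y) ≡ d (x · d y)
  d-local x y = cong a (a-local x y)

  d-+-upper : ∀ x y → d x + d y ≤ d (x + y)
  d-+-upper x y = +-lub (a·≡𝟘⇒d≤d (x + y) x (+-conicalˡ _ _ a[x+y]·x+y≡𝟘))
                        (a·≡𝟘⇒d≤d (x + y) y (+-conicalʳ _ _ a[x+y]·x+y≡𝟘))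
    where
    a[x+y]·x+y≡𝟘 : a (x + y) · x + a (x + y) · y ≡ 𝟘
    a[x+y]·x+y≡𝟘 = trans (sym (a-distribˡ (x + y) x y)) (a-annihil (x + y))

  a·a·[x+y]≡𝟘 : ∀ x y → (a x · a y) · (x + y) ≡ 𝟘
  a·a·[x+y]≡𝟘 x y = begin
    (a x · a y) · (x + y)         ≡⟨ sym (a-assoc x (a y) (x + y)) ⟩
    a x · (a y · (x + y))         ≡⟨ cong (a x ·_) (a-distribˡ y x y) ⟩
    a x · (a y · x + a y · y)     ≡⟨ cong (λ t → a x · (a y · x + t)) (a-annihil y) ⟩
    a x · (a y · x + 𝟘)           ≡⟨ cong (a x ·_) (+-identityʳ _) ⟩
    a x · (a y · x)               ≡⟨ a-assoc x (a y) x ⟩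
    (a x · a y) · x               ≡⟨ cong (_· x) (a-comm x y) ⟩
    (a y · a x) · x               ≡⟨ sym (a-assoc y (a x) x) ⟩
    a y · (a x · x)               ≡⟨ cong (a y ·_) (a-annihil x) ⟩
    a y · 𝟘                       ≡⟨ a·𝟘≡𝟘 y ⟩
    𝟘                             ∎

  d-+-lower : ∀ x y → d (x + y) ≤ d x + d y
  d-+-lower x y = trans (cong (_+ (d x + d y)) split)
    (+-lub (≤-trans (≤-trans (a·z≤z (a s) _) (a·z≤z x (d y))) (y≤x+y (d x) (d y)))
           (≤-trans (a·z≤z (a s) (d x)) (x≤x+y (d x) (d y))))
    where
    s : S
    s = x + y
    vanish : d s · (a x · a y) ≡ 𝟘
    vanish = trans (a-comm-· (a s) x y) (·≡𝟘⇒·d≡𝟘 (a x · a y) s (a·a·[x+y]≡𝟘 x y))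
    split : d s ≡ d s · (a x · d y) + d s · d x
    split = begin
      d s                                             ≡⟨ a-splitʳ (a s) x ⟩
      d s · a x + d s · d x                           ≡⟨ cong (λ t → d s · t + d s · d x) (a-splitʳ x y) ⟩
      d s · (a x · a y + a x · d y) + d s · d x       ≡⟨ cong (_+ d s · d x) (a-distribˡ (a s) _ _) ⟩
      (d s · (a x · a y) + d s · (a x · d y)) + d s · d x
        ≡⟨ cong (λ t → (t + d s · (a x · d y)) + d s · d x) vanish ⟩
      (𝟘 + d s · (a x · d y)) + d s · d x             ≡⟨ cong (_+ d s · d x) (+-identityˡ _) ⟩
      d s · (a x · d y) + d s · d x                   ∎

  d-+ : ∀ x y → d (x + y) ≡ d x + d y
  d-+ x y = ≤-antisym (d-+-lower x y) (d-+-upper x y)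

  d-𝟘 : d 𝟘 ≡ 𝟘
  d-𝟘 = trans (cong a a-𝟘) a-1σ

proposition11p2 : {ℓ : Level} (P : ProtoDioid ℓ) (a : ProtoDioid.S P → ProtoDioid.S P) →
    IsApDioid P a → IsDpDioid P (λ x → a (a x))
proposition11p2 P a ap = record
  { assoc    = AssocOnImage-⊆ (InImage-∘ a a) (IsApDioid.assoc ap)
  ; d-absorb = x≤d·x
  ; d-local  = d-local
  ; d-add    = d-+
  ; d-subid  = λ x → a≤1σ (a x)
  ; d-zero   = d-𝟘
  }
  where
  open ProtoDioidProperties P
  open ApDioidProperties P a ap
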